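{- Let $\pi$ be a $132$-avoiding permutation of length $n \ge 1$. For each insertion position $i \in \{1,\dots,n+1\}$, let $\tau_i$ be obtained by inserting a new maximum element into $\pi$ at position $i$, removing the shortest suffix whose removal makes the sequence $132$-avoiding, and standardising. Then the $n+1$ permutations $\tau_1,\dots,\tau_{n+1}$ belong to pairwise different sets $A(m,s)$; that is, for $i \ne j$, either $|\tau_i| \ne |\tau_j|$ or $\tau_i$ and $\tau_j$ have different numbers of short values.
   Context: Standardising a sequence of $k$ distinct values means replacing it by the permutation of $\{1,\dots,k\}$ order-isomorphic to it. An entry $\pi_i$ of $\pi$ is a right-to-left maximum if $\pi_i > \pi_j$ for all $j>i$; a short value is an entry that is not a right-to-left maximum. For $m \ge 1$, $s \ge 0$, $A(m,s)$ denotes the set of $132$-avoiding permutations of length $m$ with exactly $s$ short values. -}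

module Defs where

open import Data.Nat using (ℕ; zero; suc; _+_; _∸_; _<ᵇ_)
open import Data.Bool using (Bool; true; false; _∧_; _∨_; if_then_else_)
open import Data.List using (List; []; _∷_; _++_; map; take; drop; length; upTo)
open import Data.Bool.ListAction using (any)
open import Data.List.Relation.Binary.Permutation.Propositional using (_↭_)
open import Relation.Binary.PropositionalEquality using (_≡_)

IsPerm : ℕ → List ℕ → Set
IsPerm n π = π ↭ map suc (upTo n)

has32above : ℕ → List ℕ → Bool
has32above x [] = false
has32above x (y ∷ ys) = any (λ z → (x <ᵇ z) ∧ (z <ᵇ y)) ys ∨ has32above x ys

has132 : List ℕ → Bool
has132 [] = false
has132 (x ∷ xs) = has32above x xs ∨ has132 xs

Avoids132 : List ℕ → Set
Avoids132 xs = has132 xs ≡ false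

longestAvoiding : ℕ → List ℕ → ℕ
longestAvoiding zero σ = zero
longestAvoiding (suc k) σ with has132 (take (suc k) σ)
... | false = suc k
... | true  = longestAvoiding k σ

-- Remove the shortest suffix whose removal makes σ 132-avoiding
-- (equivalently keep the longest 132-avoiding prefix).
trimTo132 : List ℕ → List ℕ
trimTo132 σ = take (longestAvoiding (length σ) σ) σ

countLess : ℕ → List ℕ → ℕ
countLess x [] = 0
countLess x (y ∷ ys) = (if y <ᵇ x then 1 else 0) + countLess x ys

standardise : List ℕ → List ℕ
standardise xs = map (λ x → suc (countLess x xs)) xs

-- number of short values: entries that are not right-to-left maxima,
-- i.e. some later entry is larger
shortCount : List ℕ → ℕ
shortCount [] = 0
shortCount (x ∷ xs) = (if any (x <ᵇ_) xs then 1 else 0) + shortCount xs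

insertMax : ℕ → List ℕ → ℕ → List ℕ
insertMax n π i = take (i ∸ 1) π ++ (suc n ∷ drop (i ∸ 1) π)

tau : ℕ → List ℕ → ℕ → List ℕ
tau n π i = standardise (trimTo132 (insertMax n π i))

-- Write π = α ++ β and insert the maximum M after α. An entry c of β with
-- a < c for some a ∈ α completes the pattern a M c, whereas entries lying
-- below all of α form no pattern with M. So the trimmed sequence is
-- α ++ M ∷ s, where s is the longest prefix of β lying below every entry of
-- α. Every entry of α is short (M is to its right), hence τ has length
-- |α| + 1 + |s| and |α| + short(s) short values. If insertion points k < l
-- gave the same length, the survivors for k would be the entries δ between
-- the two points followed by the survivors for l; all of those lie below
-- every entry of δ, so the entries of δ contribute at most |δ| - 1 short
-- values and τ_k has strictly fewer short values than τ_l.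
module Submission where

open import Defs
open import Data.Bool using (Bool; true; false; _∧_; _∨_; T; if_then_else_)
open import Data.Bool.Properties using (∨-assoc; ∨-zeroʳ; ∨-conicalˡ; ∨-conicalʳ; ∧-zeroʳ; T-≡)
open import Data.Bool.ListAction using (any; or)
open import Data.Empty using (⊥-elim)
open import Data.List using (List; []; _∷_; _++_; _∷ʳ_; [_]; map; take; drop; length; upTo; takeWhile; dropWhile)
open import Data.List.Properties
  using (length-++; length-map; length-upTo; length-take; take-take; take-all; take++drop≡id; ++-assoc; map-∘; map-cong; takeWhile++dropWhile)
open import Data.List.Membership.Propositional using (_∈_)
open import Data.List.Membership.Propositional.Properties using (∈-++⁺ʳ)
open import Data.List.Relation.Unary.Any as Any using (Any; here; there)
open import Data.List.Relation.Unary.All as All using (All; []; _∷_; all?)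
import Data.List.Relation.Unary.All.Properties as All
open import Data.List.Relation.Binary.Permutation.Propositional using (↭-sym)
open import Data.List.Relation.Binary.Permutation.Propositional.Properties using (All-resp-↭; ↭-length)
open import Data.Nat using (ℕ; zero; suc; _+_; _≤_; _<_; _<ᵇ_; _≤?_; _<?_; z≤n; s≤s; s≤s⁻¹; z<s; s<s; _≟_)
open import Data.Nat.Properties
open import Data.Product using (∃; ∃₂; _×_; _,_)
open import Data.Sum as Sum using (_⊎_; inj₁; inj₂)
open import Function using (id; _∘_; Equivalence)
open import Relation.Binary using (tri<; tri≈; tri>)
open import Relation.Binary.PropositionalEquality using (_≡_; _≢_; refl; sym; trans; cong; cong₂; subst; ≢-sym; module ≡-Reasoning)
open import Relation.Nullary using (¬_; yes; no; contradiction)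
open import Relation.Unary using (Pred; Decidable)

private
  variable
    A B : Set

<ᵇ-true : ∀ {m n} → m < n → (m <ᵇ n) ≡ true
<ᵇ-true m<n = Equivalence.to T-≡ (<⇒<ᵇ m<n)

<ᵇ-false : ∀ {m n} → n ≤ m → (m <ᵇ n) ≡ false
<ᵇ-false {m} {n} n≤m with m <ᵇ n in eq
... | false = refl
... | true  = contradiction (<ᵇ⇒< m n (subst T (sym eq) _)) (≤⇒≯ n≤m)

∨-trueˡ : ∀ {a} b → a ≡ true → a ∨ b ≡ true
∨-trueˡ b refl = refl

∨-trueʳ : ∀ a {b} → b ≡ true → a ∨ b ≡ true
∨-trueʳ a refl = ∨-zeroʳ a

indicator : Bool → ℕ
indicator b = if b then 1 else 0

indicator≤1 : ∀ b → indicator b ≤ 1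
indicator≤1 true  = ≤-refl
indicator≤1 false = z≤n

any-++ : ∀ (g : A → Bool) xs {ys} → any g (xs ++ ys) ≡ any g xs ∨ any g ys
any-++ g []       = refl
any-++ g (x ∷ xs) = trans (cong (g x ∨_) (any-++ g xs)) (sym (∨-assoc (g x) _ _))

any-true : ∀ (g : A → Bool) {x xs} → x ∈ xs → g x ≡ true → any g xs ≡ true
any-true g              (here refl)  gx = ∨-trueˡ _ gx
any-true g {xs = y ∷ _} (there x∈xs) gx = ∨-trueʳ (g y) (any-true g x∈xs gx)

any-false : ∀ (g : A → Bool) {xs} → All (λ x → g x ≡ false) xs → any g xs ≡ false
any-false g []         = refl
any-false g (gx ∷ gxs) = cong₂ _∨_ gx (any-false g gxs)

any-insert : ∀ (g : A → Bool) ys {M zs} → g M ≡ false →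
  any g (ys ++ zs) ≡ false → any g (ys ++ M ∷ zs) ≡ false
any-insert g []       gM h = cong₂ _∨_ gM h
any-insert g (y ∷ ys) gM h =
  cong₂ _∨_ (∨-conicalˡ _ _ h) (any-insert g ys gM (∨-conicalʳ _ _ h))

any-map : ∀ (g : B → Bool) (f : A → B) xs → any g (map f xs) ≡ any (g ∘ f) xs
any-map g f xs = cong or (sym (map-∘ xs))

any-cong : ∀ {g h : A → Bool} → (∀ x → g x ≡ h x) → ∀ xs → any g xs ≡ any h xs
any-cong g≗h xs = cong or (map-cong g≗h xs)

any-<ᵇ-false : ∀ {x ys} → All (_≤ x) ys → any (x <ᵇ_) ys ≡ false
any-<ᵇ-false ys≤x = any-false _ (All.map <ᵇ-false ys≤x)

take-length-++ : ∀ (xs : List A) {ys} → take (length xs) (xs ++ ys) ≡ xs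
take-length-++ []       = refl
take-length-++ (x ∷ xs) = cong (x ∷_) (take-length-++ xs)

drop-length-++ : ∀ (xs : List A) {ys} → drop (length xs) (xs ++ ys) ≡ ys
drop-length-++ []       = refl
drop-length-++ (x ∷ xs) = drop-length-++ xs

take-suc-length-++ : ∀ (xs : List A) {y ys} → take (suc (length xs)) (xs ++ y ∷ ys) ≡ xs ∷ʳ y
take-suc-length-++ []       = refl
take-suc-length-++ (x ∷ xs) = cong (x ∷_) (take-suc-length-++ xs)

length-take-≤ : ∀ {l} {xs : List A} → l ≤ length xs → length (take l xs) ≡ l
length-take-≤ {l = l} {xs} l≤ = trans (length-take l xs) (m≤n⇒m⊓n≡m l≤)

splitBetween : ∀ (xs : List A) {k l} → k < l → l ≤ length xs →
  ∃₂ λ α δ → ∃ λ β → xs ≡ α ++ δ ++ β × δ ≢ [] × length α ≡ k × length (α ++ δ) ≡ l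
splitBetween (x ∷ xs) {zero} {suc l} _ (s≤s l≤) =
  [] , x ∷ take l xs , drop l xs , cong (x ∷_) (sym (take++drop≡id l xs)) ,
  (λ ()) , refl , cong suc (length-take-≤ l≤)
splitBetween (x ∷ xs) {suc k} {suc l} (s<s k<l) (s≤s l≤) with splitBetween xs k<l l≤
... | α , δ , β , eq , δ≢[] , refl , refl = x ∷ α , δ , β , cong (x ∷_) eq , δ≢[] , refl , refl

module _ {p} {P : Pred A p} (P? : Decidable P) where

  takeWhile-prefix : ∀ xs → take (length (takeWhile P? xs)) xs ≡ takeWhile P? xs
  takeWhile-prefix xs =
    trans (cong (take _) (sym (takeWhile++dropWhile P? xs))) (take-length-++ (takeWhile P? xs))

  takeWhile-++ : ∀ δ ys → length δ ≤ length (takeWhile P? (δ ++ ys)) →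
    takeWhile P? (δ ++ ys) ≡ δ ++ takeWhile P? ys
  takeWhile-++ []      ys _ = refl
  takeWhile-++ (x ∷ δ) ys le with P? x
  ... | yes _ = cong (x ∷_) (takeWhile-++ δ ys (s≤s⁻¹ le))
  ... | no  _ with () ← le

  takeWhile-maximal : ∀ xs → takeWhile P? xs ≡ xs ⊎
    ∃₂ λ c rest → takeWhile P? xs ++ c ∷ rest ≡ xs × ¬ P c
  takeWhile-maximal []       = inj₁ refl
  takeWhile-maximal (x ∷ xs) with P? x
  ... | no ¬px = inj₂ (x , xs , refl , ¬px)
  ... | yes _ with takeWhile-maximal xs
  ...   | inj₁ eq                     = inj₁ (cong (x ∷_) eq)
  ...   | inj₂ (c , rest , eq , ¬pc) = inj₂ (c , rest , cong (x ∷_) eq , ¬pc)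

between : ℕ → ℕ → ℕ → Bool
between x y z = (x <ᵇ z) ∧ (z <ᵇ y)

has32above-++ˡ : ∀ x xs {ys} → has32above x xs ≡ true → has32above x (xs ++ ys) ≡ true
has32above-++ˡ x (y ∷ xs) h with any (between x y) xs in e
... | true  = ∨-trueˡ _ (trans (any-++ _ xs) (∨-trueˡ _ e))
... | false = ∨-trueʳ _ (has32above-++ˡ x xs h)

has32above-++ʳ : ∀ x xs {ys} → has32above x ys ≡ true → has32above x (xs ++ ys) ≡ true
has32above-++ʳ x []       h = h
has32above-++ʳ x (y ∷ xs) h = ∨-trueʳ _ (has32above-++ʳ x xs h)

has132-++ˡ : ∀ xs {ys} → has132 xs ≡ true → has132 (xs ++ ys) ≡ true
has132-++ˡ (x ∷ xs) h with has32above x xs in e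
... | true  = ∨-trueˡ _ (has32above-++ˡ x xs e)
... | false = ∨-trueʳ _ (has132-++ˡ xs h)

Avoids132-++⁻ˡ : ∀ xs {ys} → Avoids132 (xs ++ ys) → Avoids132 xs
Avoids132-++⁻ˡ xs av with has132 xs in e
... | false = refl
... | true  = contradiction (trans (sym (has132-++ˡ xs e)) av) (λ ())

has132-take-mono : ∀ {k k'} σ → k ≤ k' → has132 (take k σ) ≡ true → has132 (take k' σ) ≡ true
has132-take-mono {k} {k'} σ k≤k' h =
  subst (λ τ → has132 τ ≡ true) (take++drop≡id k (take k' σ))
    (has132-++ˡ (take k (take k' σ)) (subst (λ τ → has132 τ ≡ true) (sym prefix) h))
  where
  prefix : take k (take k' σ) ≡ take k σ
  prefix = trans (take-take k k' σ) (cong (λ j → take j σ) (m≤n⇒m⊓n≡m k≤k'))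

any-between-≤ : ∀ {x y zs} → All (_≤ x) zs → any (between x y) zs ≡ false
any-between-≤ {y = y} zs≤x = any-false _ (All.map (λ {z} z≤x → cong (_∧ (z <ᵇ y)) (<ᵇ-false z≤x)) zs≤x)

has32above-≤ : ∀ {x zs} → All (_≤ x) zs → has32above x zs ≡ false
has32above-≤ []                       = refl
has32above-≤ {zs = z ∷ _} (_ ∷ zs≤x) = cong₂ _∨_ (any-between-≤ {y = z} zs≤x) (has32above-≤ zs≤x)

-- M cannot be the 2 of a new pattern, as it exceeds all of ys, nor the 3,
-- as nothing after it exceeds x.
has32above-insert : ∀ {M x} ys {zs} → All (_< M) ys → All (_≤ x) zs →
  has32above x (ys ++ zs) ≡ false → has32above x (ys ++ M ∷ zs) ≡ false
has32above-insert {M} [] _ zs≤x _ = cong₂ _∨_ (any-between-≤ {y = M} zs≤x) (has32above-≤ zs≤x)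
has32above-insert {M} {x} (y ∷ ys) (y<M ∷ ys<M) zs≤x h =
  cong₂ _∨_ (any-insert _ ys M-not-between (∨-conicalˡ _ _ h))
            (has32above-insert ys ys<M zs≤x (∨-conicalʳ _ _ h))
  where
  M-not-between : between x y M ≡ false
  M-not-between = trans (cong ((x <ᵇ M) ∧_) (<ᵇ-false (<⇒≤ y<M))) (∧-zeroʳ _)

Avoids132-insert : ∀ {M} α γ → All (_< M) α → All (_< M) γ → All (λ c → All (c ≤_) α) γ →
  Avoids132 (α ++ γ) → Avoids132 (α ++ M ∷ γ)
Avoids132-insert []      γ _         γ<M _   av = cong₂ _∨_ (has32above-≤ (All.map <⇒≤ γ<M)) av
Avoids132-insert (a ∷ α) γ (_ ∷ α<M) γ<M γ≤α av =
  cong₂ _∨_ (has32above-insert α α<M (All.map All.head γ≤α) (∨-conicalˡ _ _ av))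
            (Avoids132-insert α γ α<M γ<M (All.map All.tail γ≤α) (∨-conicalʳ _ _ av))

has132-insert : ∀ {M c} α ys → Any (_< c) α → c ∈ ys → c < M → has132 (α ++ M ∷ ys) ≡ true
has132-insert (a ∷ α) ys (here a<c) c∈ys c<M =
  ∨-trueˡ _ (has32above-++ʳ a α (∨-trueˡ _
    (any-true _ c∈ys (cong₂ _∧_ (<ᵇ-true a<c) (<ᵇ-true c<M)))))
has132-insert (a ∷ α) ys (there a<c) c∈ys c<M = ∨-trueʳ _ (has132-insert α ys a<c c∈ys c<M)

longestAvoiding-avoiding : ∀ L σ → Avoids132 (take L σ) → longestAvoiding L σ ≡ L
longestAvoiding-avoiding zero    σ _  = refl
longestAvoiding-avoiding (suc L) σ av rewrite av = refl

longestAvoiding-≡ : ∀ {K} L σ → K < L → Avoids132 (take K σ) → has132 (take (suc K) σ) ≡ true →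
  longestAvoiding L σ ≡ K
longestAvoiding-≡ (suc L) σ K<1+L av bad with has132 (take (suc L) σ) in e
... | false = contradiction (trans (sym (has132-take-mono σ K<1+L bad)) e) (λ ())
... | true with m≤n⇒m<n∨m≡n (s≤s⁻¹ K<1+L)
...   | inj₁ K<L  = longestAvoiding-≡ L σ K<L av bad
...   | inj₂ refl = longestAvoiding-avoiding L σ av

trimTo132-avoiding : ∀ σ → Avoids132 σ → trimTo132 σ ≡ σ
trimTo132-avoiding σ av =
  trans (cong (λ k → take k σ) (longestAvoiding-avoiding (length σ) σ (subst Avoids132 (sym whole) av)))
        whole
  where
  whole : take (length σ) σ ≡ σ
  whole = take-all (length σ) σ ≤-refl

trimTo132-++ : ∀ xs c rest → Avoids132 xs → has132 (xs ∷ʳ c) ≡ true → trimTo132 (xs ++ c ∷ rest) ≡ xs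
trimTo132-++ xs c rest av bad =
  trans (cong (λ k → take k σ) (longestAvoiding-≡ (length σ) σ shorter
          (subst Avoids132 (sym (take-length-++ xs)) av)
          (subst (λ τ → has132 τ ≡ true) (sym (take-suc-length-++ xs)) bad)))
        (take-length-++ xs)
  where
  σ = xs ++ c ∷ rest
  shorter : length xs < length σ
  shorter = subst (length xs <_) (sym (length-++ xs)) (m<m+n (length xs) z<s)

belowAll? : (α : List ℕ) → Decidable (λ c → All (c ≤_) α)
belowAll? α c = all? (c ≤?_) α

survivors : List ℕ → List ℕ → List ℕ
survivors α = takeWhile (belowAll? α)

survivors-below : ∀ α β → All (λ c → All (c ≤_) α) (survivors α β)
survivors-below α = All.all-takeWhile (belowAll? α)

Avoids132-survivors : ∀ {M} α β → All (_< M) (α ++ β) → Avoids132 (α ++ β) →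
  Avoids132 (α ++ M ∷ survivors α β)
Avoids132-survivors α β bounded av =
  Avoids132-insert α s (All.++⁻ˡ α bounded) (All.takeWhile⁺ (belowAll? α) (All.++⁻ʳ α bounded))
    (survivors-below α β) (Avoids132-++⁻ˡ (α ++ s) (subst Avoids132 (sym split) av))
  where
  s = survivors α β
  split : (α ++ s) ++ dropWhile (belowAll? α) β ≡ α ++ β
  split = trans (++-assoc α s _) (cong (α ++_) (takeWhile++dropWhile (belowAll? α) β))

trimTo132-insert : ∀ {M} α β → All (_< M) (α ++ β) → Avoids132 (α ++ β) →
  trimTo132 (α ++ M ∷ β) ≡ α ++ M ∷ survivors α β
trimTo132-insert {M} α β bounded av with takeWhile-maximal (belowAll? α) β
... | inj₁ s≡β =
  subst (λ γ → trimTo132 (α ++ M ∷ γ) ≡ α ++ M ∷ survivors α β) s≡β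
    (trimTo132-avoiding _ (Avoids132-survivors α β bounded av))
... | inj₂ (c , rest , s++c∷rest≡β , c≰α) =
  subst (λ γ → trimTo132 (α ++ M ∷ γ) ≡ α ++ M ∷ s) s++c∷rest≡β
    (trans (cong trimTo132 (sym (++-assoc α (M ∷ s) (c ∷ rest))))
      (trimTo132-++ (α ++ M ∷ s) c rest (Avoids132-survivors α β bounded av)
        (subst (λ τ → has132 τ ≡ true) (sym (++-assoc α (M ∷ s) [ c ]))
          (has132-insert α (s ∷ʳ c) (Any.map ≰⇒> (All.¬All⇒Any¬ (c ≤?_) α c≰α))
            (∈-++⁺ʳ s (here refl)) c<M))))
  where
  s = survivors α β
  c<M : c < M
  c<M = All.head (All.++⁻ʳ s (subst (All (_< M)) (sym s++c∷rest≡β) (All.++⁻ʳ α bounded)))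

-- Both sides are prefixes of δ ++ β, so the length hypothesis forces them to agree.
survivors-++ : ∀ α δ β → length (survivors α (δ ++ β)) ≡ length δ + length (survivors (α ++ δ) β) →
  survivors α (δ ++ β) ≡ δ ++ survivors (α ++ δ) β
survivors-++ α δ β len = trans s≡δ++t (cong (δ ++_) t≡t')
  where
  t  = survivors α β
  t' = survivors (α ++ δ) β
  s≡δ++t : survivors α (δ ++ β) ≡ δ ++ t
  s≡δ++t = takeWhile-++ (belowAll? α) δ β (subst (length δ ≤_) (sym len) (m≤m+n _ _))
  |t|≡|t'| : length t ≡ length t'
  |t|≡|t'| = +-cancelˡ-≡ (length δ) _ _ (trans (sym (length-++ δ)) (trans (cong length (sym s≡δ++t)) len))
  t≡t' : t ≡ t'
  t≡t' = trans (sym (takeWhile-prefix _ β))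
           (trans (cong (λ k → take k β) |t|≡|t'|) (takeWhile-prefix _ β))

shortCount-map : ∀ (f : ℕ → ℕ) ys → All (λ x → ∀ z → (f x <ᵇ f z) ≡ (x <ᵇ z)) ys →
  shortCount (map f ys) ≡ shortCount ys
shortCount-map f []       []         = refl
shortCount-map f (y ∷ ys) (fy ∷ fys) =
  cong₂ (λ b r → indicator b + r) (trans (any-map _ f ys) (any-cong fy ys)) (shortCount-map f ys fys)

countLess-mono : ∀ {z x} → z ≤ x → ∀ L → countLess z L ≤ countLess x L
countLess-mono z≤x []      = z≤n
countLess-mono {z} {x} z≤x (y ∷ L) with y <? z
... | yes y<z rewrite <ᵇ-true y<z | <ᵇ-true (<-≤-trans y<z z≤x) = s≤s (countLess-mono z≤x L)
... | no  y≮z rewrite <ᵇ-false (≮⇒≥ y≮z) = ≤-trans (countLess-mono z≤x L) (m≤n+m _ _)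

countLess-strict : ∀ {x z L} → x < z → x ∈ L → countLess x L < countLess z L
countLess-strict {x} {z} {_ ∷ L} x<z (here refl) rewrite <ᵇ-false (≤-refl {x}) | <ᵇ-true x<z =
  s≤s (countLess-mono (<⇒≤ x<z) L)
countLess-strict {x} {z} {y ∷ L} x<z (there x∈L) with y <? x
... | yes y<x rewrite <ᵇ-true y<x | <ᵇ-true (<-trans y<x x<z) = s≤s (countLess-strict x<z x∈L)
... | no  y≮x rewrite <ᵇ-false (≮⇒≥ y≮x) = <-≤-trans (countLess-strict x<z x∈L) (m≤n+m _ _)

rank : List ℕ → ℕ → ℕ
rank L x = suc (countLess x L)

rank-<ᵇ : ∀ {L x} z → x ∈ L → (rank L x <ᵇ rank L z) ≡ (x <ᵇ z)
rank-<ᵇ {L} {x} z x∈L with x <? z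
... | yes x<z = trans (<ᵇ-true (s<s (countLess-strict x<z x∈L))) (sym (<ᵇ-true x<z))
... | no  x≮z = trans (<ᵇ-false (s≤s (countLess-mono (≮⇒≥ x≮z) L))) (sym (<ᵇ-false (≮⇒≥ x≮z)))

shortCount-standardise : ∀ xs → shortCount (standardise xs) ≡ shortCount xs
shortCount-standardise xs = shortCount-map (rank xs) xs (All.tabulate (λ x∈xs z → rank-<ᵇ z x∈xs))

shortCount-insert : ∀ {M} α γ → All (_< M) α → All (_< M) γ →
  shortCount (α ++ M ∷ γ) ≡ length α + shortCount γ
shortCount-insert [] γ _ γ<M =
  cong (λ b → indicator b + shortCount γ) (any-<ᵇ-false (All.map <⇒≤ γ<M))
shortCount-insert (a ∷ α) γ (a<M ∷ α<M) γ<M =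
  cong₂ _+_ (cong indicator (any-true _ (∈-++⁺ʳ α (here refl)) (<ᵇ-true a<M)))
            (shortCount-insert α γ α<M γ<M)

shortCount-++-< : ∀ x xs ys → All (λ e → All (_≤ e) ys) (x ∷ xs) →
  shortCount (x ∷ xs ++ ys) < length (x ∷ xs) + shortCount ys
shortCount-++-< x []        ys (ys≤x ∷ []) rewrite any-<ᵇ-false ys≤x = ≤-refl
shortCount-++-< x (x' ∷ xs) ys (_ ∷ h)     =
  +-mono-≤-< (indicator≤1 (any (x <ᵇ_) (x' ∷ xs ++ ys))) (shortCount-++-< x' xs ys h)

shortCount-survivors-< : ∀ α δ β → δ ≢ [] →
  length (survivors α (δ ++ β)) ≡ length δ + length (survivors (α ++ δ) β) →
  shortCount (survivors α (δ ++ β)) < length δ + shortCount (survivors (α ++ δ) β)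
shortCount-survivors-< α []       β δ≢[] _   = ⊥-elim (δ≢[] refl)
shortCount-survivors-< α (x ∷ xs) β _    len =
  subst (λ s → shortCount s < length δ + shortCount t') (sym (survivors-++ α δ β len))
    (shortCount-++-< x xs t' (All.++⁻ʳ α (All.All-swap (survivors-below (α ++ δ) β))))
  where
  δ  = x ∷ xs
  t' = survivors (α ++ δ) β

insertMax-++ : ∀ n α β → insertMax n (α ++ β) (suc (length α)) ≡ α ++ suc n ∷ β
insertMax-++ n α β = cong₂ (λ γ ε → γ ++ suc n ∷ ε) (take-length-++ α) (drop-length-++ α)

entries-bounded : ∀ {n π} → IsPerm n π → All (_< suc n) π
entries-bounded {n} perm = All-resp-↭ (↭-sym perm) (All.map⁺ (All.applyUpTo⁺₁ id n s<s))

length-perm : ∀ {n π} → IsPerm n π → length π ≡ n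
length-perm {n} perm = trans (↭-length perm) (trans (length-map suc (upTo n)) (length-upTo n))

module _ {n π} (perm : IsPerm n π) (av : Avoids132 π) where

  private
    bounded-split : ∀ α β → π ≡ α ++ β → All (_< suc n) (α ++ β)
    bounded-split α β π≡ = subst (All (_< suc n)) π≡ (entries-bounded perm)

  tau-≡ : ∀ α β → π ≡ α ++ β → tau n π (suc (length α)) ≡ standardise (α ++ suc n ∷ survivors α β)
  tau-≡ α β π≡ =
    subst (λ σ → tau n σ (suc (length α)) ≡ standardise (α ++ suc n ∷ survivors α β)) (sym π≡)
      (cong standardise (trans (cong trimTo132 (insertMax-++ n α β))
        (trimTo132-insert α β (bounded-split α β π≡) (subst Avoids132 π≡ av))))

  length-tau : ∀ α β → π ≡ α ++ β →
    length (tau n π (suc (length α))) ≡ length α + suc (length (survivors α β))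
  length-tau α β π≡ = begin
    length (tau n π (suc (length α)))            ≡⟨ cong length (tau-≡ α β π≡) ⟩
    length (standardise (α ++ suc n ∷ s))        ≡⟨ length-map _ (α ++ suc n ∷ s) ⟩
    length (α ++ suc n ∷ s)                      ≡⟨ length-++ α ⟩
    length α + suc (length s)                    ∎
    where
    open ≡-Reasoning
    s = survivors α β

  shortCount-tau : ∀ α β → π ≡ α ++ β →
    shortCount (tau n π (suc (length α))) ≡ length α + shortCount (survivors α β)
  shortCount-tau α β π≡ = begin
    shortCount (tau n π (suc (length α)))        ≡⟨ cong shortCount (tau-≡ α β π≡) ⟩
    shortCount (standardise (α ++ suc n ∷ s))    ≡⟨ shortCount-standardise (α ++ suc n ∷ s) ⟩
    shortCount (α ++ suc n ∷ s)                  ≡⟨ shortCount-insert α s (All.++⁻ˡ α bounded)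
                                                      (All.takeWhile⁺ (belowAll? α) (All.++⁻ʳ α bounded)) ⟩
    length α + shortCount s                      ∎
    where
    open ≡-Reasoning
    s = survivors α β
    bounded : All (_< suc n) (α ++ β)
    bounded = bounded-split α β π≡

  shortCount-tau-< : ∀ α δ β → π ≡ α ++ δ ++ β → δ ≢ [] →
    length (tau n π (suc (length α))) ≡ length (tau n π (suc (length (α ++ δ)))) →
    shortCount (tau n π (suc (length α))) < shortCount (tau n π (suc (length (α ++ δ))))
  shortCount-tau-< α δ β π≡ δ≢[] sameLength = begin-strict
    shortCount (tau n π (suc (length α)))         ≡⟨ shortCount-tau α (δ ++ β) π≡ ⟩
    length α + shortCount s                       <⟨ +-monoʳ-< (length α) (shortCount-survivors-< α δ β δ≢[] |s|≡) ⟩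
    length α + (length δ + shortCount s')         ≡⟨ sym (+-assoc (length α) _ _) ⟩
    length α + length δ + shortCount s'           ≡⟨ cong (_+ shortCount s') (sym (length-++ α)) ⟩
    length (α ++ δ) + shortCount s'               ≡⟨ sym (shortCount-tau (α ++ δ) β π≡') ⟩
    shortCount (tau n π (suc (length (α ++ δ))))  ∎
    where
    open ≤-Reasoning
    s  = survivors α (δ ++ β)
    s' = survivors (α ++ δ) β
    π≡' : π ≡ (α ++ δ) ++ β
    π≡' = trans π≡ (sym (++-assoc α δ β))
    |s|≡ : length s ≡ length δ + length s'
    |s|≡ = suc-injective (+-cancelˡ-≡ (length α) _ _ (begin-equality
      length α + suc (length s)              ≡⟨ sym (length-tau α (δ ++ β) π≡) ⟩
      length (tau n π (suc (length α)))      ≡⟨ sameLength ⟩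
      length (tau n π (suc (length (α ++ δ)))) ≡⟨ length-tau (α ++ δ) β π≡' ⟩
      length (α ++ δ) + suc (length s')      ≡⟨ cong (_+ suc (length s')) (length-++ α) ⟩
      length α + length δ + suc (length s')  ≡⟨ +-assoc (length α) _ _ ⟩
      length α + (length δ + suc (length s')) ≡⟨ cong (length α +_) (+-suc (length δ) _) ⟩
      length α + suc (length δ + length s')  ∎))

  insertions-distinguished : ∀ {k l} → k < l → l ≤ n →
    (length (tau n π (suc k)) ≢ length (tau n π (suc l)))
      ⊎ (shortCount (tau n π (suc k)) ≢ shortCount (tau n π (suc l)))
  insertions-distinguished k<l l≤n
    with splitBetween π k<l (subst (_ ≤_) (sym (length-perm perm)) l≤n)
  ... | α , δ , β , π≡ , δ≢[] , refl , refl
    with length (tau n π (suc (length α))) ≟ length (tau n π (suc (length (α ++ δ))))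
  ...   | no  lengths≢ = inj₁ lengths≢
  ...   | yes lengths≡ = inj₂ (<⇒≢ (shortCount-tau-< α δ β π≡ δ≢[] lengths≡))

mainTheorem3 : (n : ℕ) → (π : List ℕ) → 1 ≤ n → IsPerm n π → Avoids132 π →
    (i j : ℕ) → 1 ≤ i → i ≤ suc n → 1 ≤ j → j ≤ suc n → i ≢ j →
    (length (tau n π i) ≢ length (tau n π j))
      ⊎ (shortCount (tau n π i) ≢ shortCount (tau n π j))
mainTheorem3 n π _ perm av (suc k) (suc l) _ (s≤s k≤n) _ (s≤s l≤n) i≢j with <-cmp k l
... | tri< k<l _ _ = insertions-distinguished perm av k<l l≤n
... | tri≈ _ k≡l _ = ⊥-elim (i≢j (cong suc k≡l))
... | tri> _ _ l<k = Sum.map ≢-sym ≢-sym (insertions-distinguished perm av l<k k≤n)
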